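{- $\inf_{\mathcal I\in\textsc{Indep}}\mathsf{OFF}(\mathcal I)/\mathsf{LP}(\mathcal I)=0$. Moreover this infimum is $0$ even when restricted to either (i) instances with $n=m=1$, or (ii) instances with $n>1$, $m=1$, and $\Pr[D_1\le\sum_{i=1}^n k_i]=1$.
   Context: An instance $\mathcal{I}$ consists of: positive integers $n$ (resources) and $m$ (query types); rewards $r_{i,j}\ge 0$; integer capacities $k_i\ge1$; and a random demand vector $\mathbf D=(D_1,\dots,D_m)$ of nonnegative integers with known distribution. $\mathsf{OFF}_{\mathcal I}(\mathbf D)$ is the maximum of $\sum_{i,j}r_{i,j}x_{i,j}$ over $x\ge0$ with $\sum_j x_{i,j}\le k_i$ for all $i$ and $\sum_i x_{i,j}\le D_j$ for all $j$ (maximum-weight offline matching), and $\mathsf{OFF}(\mathcal I)=\mathbb E[\mathsf{OFF}_{\mathcal I}(\mathbf D)]$. $\mathsf{LP}(\mathcal I)$ (the fluid LP) is the optimal value of: maximize $\sum_{i,j}r_{i,j}x_{i,j}$ subject to $\sum_j x_{i,j}\le k_i$ for all $i\in[n]$, $\sum_i x_{i,j}\le\mathbb E[D_j]$ for all $j\in[m]$, $x\ge0$. $\mathcal I\in\textsc{Indep}$ means $D_1,\dots,D_m$ are mutually independent with arbitrary distributions. -}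

module Defs where

open import Data.Nat as ℕ using (ℕ; zero; suc)
open import Data.Integer using (+_)
open import Data.Rational using (ℚ; 0ℚ; 1ℚ; _+_; _*_; _≤_; _<_; _/_)
open import Data.Fin using (Fin)
import Data.Fin as F
open import Data.List using (List; []; _∷_; map; concatMap; foldr)
open import Data.List.Relation.Unary.All using (All)
open import Data.Product using (Σ; ∃; _×_; _,_; proj₁; proj₂)
open import Data.Vec.Functional using (Vector) renaming (_∷_ to _∷ᵥ_)
open import Relation.Binary.PropositionalEquality using (_≡_)

ℕ→ℚ : ℕ → ℚ
ℕ→ℚ n = (+ n) / 1

sumFin : (n : ℕ) → (Fin n → ℚ) → ℚ
sumFin zero    f = 0ℚ
sumFin (suc n) f = f F.zero + sumFin n (λ i → f (F.suc i))

sumℕ : (n : ℕ) → (Fin n → ℕ) → ℕ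
sumℕ zero    f = 0
sumℕ (suc n) f = f F.zero ℕ.+ sumℕ n (λ i → f (F.suc i))

-- A finitely supported distribution on ℕ: list of (value, probability) atoms.
Dist : Set
Dist = List (ℕ × ℚ)

probMass : Dist → ℚ
probMass = foldr (λ a s → proj₂ a + s) 0ℚ

IsDist : Dist → Set
IsDist d = All (λ a → 0ℚ ≤ proj₂ a) d × probMass d ≡ 1ℚ

mean : Dist → ℚ
mean = foldr (λ a s → ℕ→ℚ (proj₁ a) * proj₂ a + s) 0ℚ

joint : (m : ℕ) → (Fin m → Dist) → List (Vector ℕ m × ℚ)
joint zero    ds = ((λ ()) , 1ℚ) ∷ []
joint (suc m) ds =
  concatMap (λ a → map (λ b → (proj₁ a ∷ᵥ proj₁ b) , (proj₂ a * proj₂ b))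
                       (joint m (λ j → ds (F.suc j))))
            (ds F.zero)

expect : (m : ℕ) → (Fin m → Dist) → (Vector ℕ m → ℚ) → ℚ
expect m ds f = foldr (λ a s → proj₂ a * f (proj₁ a) + s) 0ℚ (joint m ds)

-- An instance in Indep (independent demands with finitely supported laws,
-- rational rewards).
record Instance : Set where
  field
    n   : ℕ
    m   : ℕ
    r   : Fin n → Fin m → ℚ
    k   : Fin n → ℕ
    dem : Fin m → Dist

record ValidInstance (I : Instance) : Set where
  open Instance I
  field
    r-nonneg : ∀ i j → 0ℚ ≤ r i j
    k-pos    : ∀ i → 1 ℕ.≤ k i
    dem-dist : ∀ j → IsDist (dem j)

module _ (I : Instance) where
  open Instance I

  objective : (Fin n → Fin m → ℚ) → ℚ
  objective x = sumFin n (λ i → sumFin m (λ j → r i j * x i j))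

  Feasible : (Fin m → ℚ) → (Fin n → Fin m → ℚ) → Set
  Feasible c x =
    (∀ i j → 0ℚ ≤ x i j) ×
    (∀ i → sumFin m (λ j → x i j) ≤ ℕ→ℚ (k i)) ×
    (∀ j → sumFin n (λ i → x i j) ≤ c j)

  IsOptValue : (Fin m → ℚ) → ℚ → Set
  IsOptValue c v =
    (Σ (Fin n → Fin m → ℚ) λ x → Feasible c x × objective x ≡ v) ×
    (∀ x → Feasible c x → objective x ≤ v)

  IsOFFvalue : Vector ℕ m → ℚ → Set
  IsOFFvalue d v = IsOptValue (λ j → ℕ→ℚ (d j)) v

  IsLPvalue : ℚ → Set
  IsLPvalue v = IsOptValue (λ j → mean (dem j)) v

  RatioBelow : ℚ → Set
  RatioBelow ε =
    Σ (Vector ℕ m → ℚ) λ off → (∀ d → IsOFFvalue d (off d)) ×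
    Σ ℚ λ lp → IsLPvalue lp × expect m dem off < ε * lp

-- Pr[D_1 ≤ Σ_i k_i] = 1 (every atom of positive probability is ≤ Σ k)
DemandBounded : (I : Instance) → Set
DemandBounded I = ∀ (z : Fin m) → All (λ a → 0ℚ < proj₂ a → proj₁ a ℕ.≤ sumℕ n k) (dem z)
  where open Instance I

module Submission where

-- A single query type whose demand is N with probability 1/N and 0 otherwise has mean 1,
-- so the fluid LP can fill one unit-capacity, unit-reward resource and LP = 1.  Offline,
-- that resource earns 1 only when the demand actually arrives, so OFF = Pr[D ≥ 1] = 1/N.
-- Worthless resources of capacity N may be added to make the demand bounded by Σ k.

open import Data.Fin using (Fin; zero; suc)
open import Data.Integer as ℤ using (+_; +[1+_])
open import Data.List using ([]; _∷_)
open import Data.List.Relation.Unary.All using ([]; _∷_)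
open import Data.Nat as ℕ using (ℕ; suc; _<_; s≤s; z≤n)
import Data.Nat.Properties as ℕ
open import Data.Nat.Coprimality using (1-coprimeTo; sym)
open import Data.Product using (Σ; _×_; _,_)
open import Data.Rational as ℚ
  using (ℚ; mkℚ; 0ℚ; 1ℚ; _+_; _*_; _-_; _⊓_; _≤_; ↧ₙ_; *≤*; *<*)
  renaming (_<_ to _<ℚ_)
open import Data.Rational.Properties
open import Data.Rational.Solver using (module +-*-Solver)
open import Data.Vec.Functional using (Vector)
open import Relation.Binary.PropositionalEquality
  using (_≡_; refl; cong; cong₂; subst; module ≡-Reasoning)

open import Defs

1/suc : ℕ → ℚ
1/suc n = mkℚ (+ 1) n (1-coprimeTo (suc n))

ℕ→ℚ-suc : ∀ n → ℕ→ℚ (suc n) ≡ mkℚ (+ suc n) 0 (sym (1-coprimeTo (suc n)))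
ℕ→ℚ-suc n = ↥p/↧p≡p (mkℚ (+ suc n) 0 (sym (1-coprimeTo (suc n))))

ℕ→ℚ-suc*1/suc : ∀ n → ℕ→ℚ (suc n) * 1/suc n ≡ 1ℚ
ℕ→ℚ-suc*1/suc n rewrite ℕ→ℚ-suc n = *-inverseʳ (mkℚ (+ suc n) 0 (sym (1-coprimeTo (suc n))))

0≤ℕ→ℚ : ∀ n → 0ℚ ≤ ℕ→ℚ n
0≤ℕ→ℚ 0       = ≤-refl
0≤ℕ→ℚ (suc n) rewrite ℕ→ℚ-suc n = *≤* (ℤ.+≤+ z≤n)

1≤ℕ→ℚ-suc : ∀ n → 1ℚ ≤ ℕ→ℚ (suc n)
1≤ℕ→ℚ-suc n rewrite ℕ→ℚ-suc n = *≤* (ℤ.+≤+ (s≤s z≤n))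

0≤1/suc : ∀ n → 0ℚ ≤ 1/suc n
0≤1/suc n = *≤* (ℤ.+≤+ z≤n)

1/suc≤1 : ∀ n → 1/suc n ≤ 1ℚ
1/suc≤1 n = *≤* (ℤ.+≤+ (s≤s z≤n))

0≤1 : 0ℚ ≤ 1ℚ
0≤1 = *≤* (ℤ.+≤+ z≤n)

-- 1/(↧ε + 1) < 1/↧ε ≤ ε, as the numerator of ε is at least 1.
1/suc-↧ₙ-< : ∀ ε → 0ℚ <ℚ ε → 1/suc (↧ₙ ε) <ℚ ε
1/suc-↧ₙ-< (mkℚ +[1+ a ] d _) _ =
  *<* (ℤ.+<+ (s≤s (s≤s (ℕ.+-monoʳ-≤ d z≤n))))
1/suc-↧ₙ-< (mkℚ (+ 0) _ _)      (*<* (ℤ.+<+ ()))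
1/suc-↧ₙ-< (mkℚ ℤ.-[1+ _ ] _ _) (*<* ())

p+[1-p]≡1 : ∀ p → p + ((1ℚ - p) + 0ℚ) ≡ 1ℚ
p+[1-p]≡1 = solve 1 (λ p → p :+ ((con 1ℚ :- p) :+ con 0ℚ) := con 1ℚ) refl
  where open +-*-Solver

p≤q⇒0≤q-p : ∀ {p q} → p ≤ q → 0ℚ ≤ q - p
p≤q⇒0≤q-p {p} {q} p≤q = subst (_≤ q - p) (+-inverseʳ p) (+-monoˡ-≤ (ℚ.- p) p≤q)

spike : ℕ → Dist
spike n = (suc n , 1/suc n) ∷ (0 , 1ℚ - 1/suc n) ∷ []

spike-isDist : ∀ n → IsDist (spike n)
spike-isDist n = (0≤1/suc n ∷ p≤q⇒0≤q-p (1/suc≤1 n) ∷ []) , p+[1-p]≡1 (1/suc n)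

mean-spike : ∀ n → mean (spike n) ≡ 1ℚ
mean-spike n rewrite ℕ→ℚ-suc*1/suc n | *-zeroˡ (1ℚ - 1/suc n) = refl

p≤p+q : ∀ p {q} → 0ℚ ≤ q → p ≤ p + q
p≤p+q p 0≤q = subst (_≤ p + _) (+-identityʳ p) (+-monoʳ-≤ p 0≤q)

sumFin-zero : ∀ n {f : Fin n → ℚ} → (∀ i → f i ≡ 0ℚ) → sumFin n f ≡ 0ℚ
sumFin-zero 0       _    = refl
sumFin-zero (suc n) f≡0 = cong₂ _+_ (f≡0 zero) (sumFin-zero n (λ i → f≡0 (suc i)))

sumFin-nonneg : ∀ n {f : Fin n → ℚ} → (∀ i → 0ℚ ≤ f i) → 0ℚ ≤ sumFin n f
sumFin-nonneg 0       _    = ≤-refl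
sumFin-nonneg (suc n) 0≤f = +-mono-≤ (0≤f zero) (sumFin-nonneg n (λ i → 0≤f (suc i)))

spikeInstance : (e n : ℕ) → Instance
spikeInstance e n = record
  { n = suc e ; m = 1 ; r = reward ; k = capacity ; dem = λ _ → spike n }
  where
  reward : Fin (suc e) → Fin 1 → ℚ
  reward zero    _ = 1ℚ
  reward (suc _) _ = 0ℚ
  capacity : Fin (suc e) → ℕ
  capacity zero    = 1
  capacity (suc _) = suc n

spikeInstance-valid : ∀ e n → ValidInstance (spikeInstance e n)
spikeInstance-valid e n = record
  { r-nonneg = reward-nonneg ; k-pos = capacity-pos ; dem-dist = λ _ → spike-isDist n }
  where
  reward-nonneg : ∀ i j → 0ℚ ≤ Instance.r (spikeInstance e n) i j
  reward-nonneg zero    _ = 0≤1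
  reward-nonneg (suc _) _ = ≤-refl
  capacity-pos : ∀ i → 1 ℕ.≤ Instance.k (spikeInstance e n) i
  capacity-pos zero    = s≤s z≤n
  capacity-pos (suc _) = s≤s z≤n

spikeInstance-demandBounded : ∀ e n → DemandBounded (spikeInstance (suc e) n)
spikeInstance-demandBounded e n zero =
  (λ _ → ℕ.m≤n⇒m≤1+n (ℕ.m≤m+n (suc n) _)) ∷ (λ _ → z≤n) ∷ []

objective-spikeInstance : ∀ e n x → objective (spikeInstance e n) x ≡ x zero zero
objective-spikeInstance e n x = begin
  (1ℚ * x zero zero + 0ℚ) + sumFin e (λ i → 0ℚ * x (suc i) zero + 0ℚ)
    ≡⟨ cong₂ _+_ (+-identityʳ (1ℚ * x zero zero))
                 (sumFin-zero e (λ i → cong (_+ 0ℚ) (*-zeroˡ (x (suc i) zero)))) ⟩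
  1ℚ * x zero zero + 0ℚ
    ≡⟨ +-identityʳ _ ⟩
  1ℚ * x zero zero
    ≡⟨ *-identityˡ _ ⟩
  x zero zero ∎
  where open ≡-Reasoning

spikeInstance-optValue : ∀ e n (c : Fin 1 → ℚ) → 0ℚ ≤ c zero →
                         IsOptValue (spikeInstance e n) c (1ℚ ⊓ c zero)
spikeInstance-optValue e n c 0≤c =
  (x⋆ , (x⋆-nonneg , x⋆-rows , x⋆-column) , objective-spikeInstance e n x⋆) , bound
  where
  v = 1ℚ ⊓ c zero
  x⋆ : Fin (suc e) → Fin 1 → ℚ
  x⋆ zero    _ = v
  x⋆ (suc _) _ = 0ℚ
  x⋆-nonneg : ∀ i j → 0ℚ ≤ x⋆ i j
  x⋆-nonneg zero    _ = ⊓-glb 0≤1 0≤c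
  x⋆-nonneg (suc _) _ = ≤-refl
  x⋆-rows : ∀ i → sumFin 1 (x⋆ i) ≤ ℕ→ℚ (Instance.k (spikeInstance e n) i)
  x⋆-rows zero    rewrite +-identityʳ v = p⊓q≤p 1ℚ (c zero)
  x⋆-rows (suc _) = 0≤ℕ→ℚ (suc n)
  x⋆-column : ∀ j → sumFin (suc e) (λ i → x⋆ i j) ≤ c j
  x⋆-column zero rewrite sumFin-zero e {λ _ → 0ℚ} (λ _ → refl) | +-identityʳ v =
    p⊓q≤q 1ℚ (c zero)
  bound : ∀ x → Feasible (spikeInstance e n) c x → objective (spikeInstance e n) x ≤ v
  bound x (x-nonneg , x-rows , x-column) rewrite objective-spikeInstance e n x =
    ⊓-glb (subst (_≤ 1ℚ) (+-identityʳ _) (x-rows zero))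
          (≤-trans (p≤p+q _ (sumFin-nonneg e (λ i → x-nonneg (suc i) zero))) (x-column zero))

offline : Vector ℕ 1 → ℚ
offline d = 1ℚ ⊓ ℕ→ℚ (d zero)

expect-offline-spike : ∀ n → expect 1 (λ _ → spike n) offline ≡ 1/suc n
expect-offline-spike n
  rewrite p≤q⇒p⊓q≡p (1≤ℕ→ℚ-suc n) | p≥q⇒p⊓q≡q 0≤1 = identity (1/suc n) (1ℚ - 1/suc n)
  where
  open +-*-Solver
  identity : ∀ p q → p * 1ℚ * 1ℚ + (q * 1ℚ * 0ℚ + 0ℚ) ≡ p
  identity = solve 2 (λ p q → p :* con 1ℚ :* con 1ℚ :+ (q :* con 1ℚ :* con 0ℚ :+ con 0ℚ) := p) refl

spikeInstance-ratioBelow : ∀ e n ε → 1/suc n <ℚ ε → RatioBelow (spikeInstance e n) ε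
spikeInstance-ratioBelow e n ε 1/suc<ε =
  offline , (λ d → spikeInstance-optValue e n _ (0≤ℕ→ℚ (d zero))) ,
  1ℚ ⊓ mean (spike n) , spikeInstance-optValue e n _ 0≤mean , OFF<ε*LP
  where
  0≤mean : 0ℚ ≤ mean (spike n)
  0≤mean rewrite mean-spike n = 0≤1
  OFF<ε*LP : expect 1 (λ _ → spike n) offline <ℚ ε * (1ℚ ⊓ mean (spike n))
  OFF<ε*LP rewrite mean-spike n | ⊓-idem 1ℚ | *-identityʳ ε | expect-offline-spike n = 1/suc<ε

proposition1 :
    (∀ (ε : ℚ) → 0ℚ <ℚ ε →
      Σ Instance λ I → ValidInstance I × RatioBelow I ε) ×
    (∀ (ε : ℚ) → 0ℚ <ℚ ε →
      Σ Instance λ I → ValidInstance I ×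
        Instance.n I ≡ 1 × Instance.m I ≡ 1 × RatioBelow I ε) ×
    (∀ (ε : ℚ) → 0ℚ <ℚ ε →
      Σ Instance λ I → ValidInstance I ×
        1 < Instance.n I × Instance.m I ≡ 1 × DemandBounded I × RatioBelow I ε)
proposition1 =
  (λ ε 0<ε → spikeInstance 0 (↧ₙ ε) , spikeInstance-valid 0 (↧ₙ ε) , ratioBelow 0 ε 0<ε) ,
  (λ ε 0<ε → spikeInstance 0 (↧ₙ ε) , spikeInstance-valid 0 (↧ₙ ε) ,
             refl , refl , ratioBelow 0 ε 0<ε) ,
  (λ ε 0<ε → spikeInstance 1 (↧ₙ ε) , spikeInstance-valid 1 (↧ₙ ε) ,
             s≤s (s≤s z≤n) , refl , spikeInstance-demandBounded 0 (↧ₙ ε) , ratioBelow 1 ε 0<ε)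
  where
  ratioBelow : ∀ e ε → 0ℚ <ℚ ε → RatioBelow (spikeInstance e (↧ₙ ε)) ε
  ratioBelow e ε 0<ε = spikeInstance-ratioBelow e (↧ₙ ε) ε (1/suc-↧ₙ-< ε 0<ε)
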